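{- Let $n \ge 1$ and $p \in [0,1]$. Let $\mathcal{D}_p$ be the distribution on pairs $(A,B)$ of subsets of $[n]$ in which each $i \in [n]$ is included in $A$ independently with probability $p$ and in $B$ independently with probability $p$ (all $2n$ events independent). Let $f$ be any function assigning to each nonempty $A \subseteq [n]$ an element $f(A) \in A$, and $g$ any function assigning to each nonempty $B \subseteq [n]$ an element $g(B) \in B$. Then $$\Pr_{(A,B) \sim \mathcal{D}_p}\big[A \neq \emptyset,\ B \neq \emptyset,\ f(A) = g(B)\big] \le \frac{p}{2-p},$$ i.e. the error $\mathrm{err}_{\mathcal{D}_p}(f,g) := 1 - \Pr[A\neq\emptyset, B\neq\emptyset, f(A)=g(B)]$ satisfies $\mathrm{err}_{\mathcal{D}_p}(f,g) \ge \frac{2(1-p)}{2-p}$.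
   Context: This concerns the constrained agreement problem: Alice receives $A \subseteq [n]$ and must output an element of $A$, Bob receives $B \subseteq [n]$ and must output an element of $B$, with $(A,B)$ drawn from a distribution on pairs of subsets; the error is the probability that their outputs differ. Deterministic strategies $(f,g)$ are considered.
   Formalization: The probability p ranges over the rationals in $[0,1]$ rather than over all real numbers in $[0,1]$. -}

module Defs where

open import Data.Nat using (ℕ; zero; suc)
open import Data.Bool using (Bool; true; false; if_then_else_)
open import Data.Vec using (Vec; []; _∷_)
open import Data.List using (List; []; _∷_; map; concatMap; foldr)
open import Data.Fin using (Fin)
open import Data.Fin.Properties using (_≟_)
open import Data.Fin.Subset using (Subset)
open import Data.Fin.Subset.Properties using (nonempty?)
open import Data.Rational using (ℚ; 0ℚ; 1ℚ; _+_; _*_; _-_)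
open import Relation.Nullary using (yes; no)

allSubsets : (n : ℕ) → List (Subset n)
allSubsets zero = [] ∷ []
allSubsets (suc n) = concatMap (λ s → (true ∷ s) ∷ (false ∷ s) ∷ []) (allSubsets n)

weight : {n : ℕ} → ℚ → Subset n → ℚ
weight p [] = 1ℚ
weight p (b ∷ s) = (if b then p else 1ℚ - p) * weight p s

sumSubsets : (n : ℕ) → (Subset n → ℚ) → ℚ
sumSubsets n h = foldr _+_ 0ℚ (map h (allSubsets n))

agree : {n : ℕ} → (Subset n → Fin n) → (Subset n → Fin n) → Subset n → Subset n → ℚ
agree f g A B with nonempty? A | nonempty? B
... | yes _ | yes _ with f A ≟ g B
...   | yes _ = 1ℚ
...   | no _ = 0ℚ
agree f g A B | _ | _ = 0ℚ

successProb : (n : ℕ) → ℚ → (Subset n → Fin n) → (Subset n → Fin n) → ℚ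
successProb n p f g =
  sumSubsets n (λ A → sumSubsets n (λ B → weight p A * weight p B * agree f g A B))

-- Write a = (Pr[f(A) = i])ᵢ and b = (Pr[g(B) = i])ᵢ. By independence of A and B the success
-- probability is Σ aᵢ bᵢ ≤ (Σ aᵢ² + Σ bᵢ²) / 2, so it suffices to show that the collision
-- probability Σ aᵢ² of any choice function is at most p / (2 - p), the limit of its value
-- for f = min as n → ∞. This goes by induction on n: let j maximise aᵢ and condition on whether j ∈ A.
-- Then a_j = p u and aᵢ = p αᵢ + (1 - p) βᵢ for i ≠ j, where u + Σ αᵢ ≤ 1 and β is the
-- choice distribution of f restricted to subsets avoiding j; since aᵢ ≤ a_j, the square
-- aᵢ² is at most 2 a_j p αᵢ + (1 - p)² βᵢ², and the induction hypothesis on β closes the step.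
module Submission where

open import Defs
open import Algebra.Bundles using (Ring)
open import Data.Bool using (true; false)
open import Data.Empty using (⊥-elim)
open import Data.Fin using (Fin; zero; suc; punchIn; punchOut)
open import Data.Fin.Properties using (_≟_; punchInᵢ≢i; punchIn-punchOut; punchIn-injective)
open import Data.Fin.Subset using (Subset; Nonempty; _∈_)
open import Data.Fin.Subset.Properties using (nonempty?)
open import Data.List using (List; []; _∷_; map; foldr; concatMap)
open import Data.Maybe using (Maybe; just; nothing)
open import Data.Maybe.Properties using (just-injective)
open import Data.Nat using (ℕ; zero; suc; _≥_)
open import Data.Product using (∃; _,_)
open import Data.Sum using (inj₁; inj₂)
open import Data.Rational using (ℚ; 0ℚ; 1ℚ; _≤_; _*_; _-_; _+_; -_; nonNegative; nonPositive)
open import Data.Rational.Properties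
  using ( ≤-refl; ≤-reflexive; ≤-trans; ≤-total; +-mono-≤; +-monoˡ-≤; +-monoʳ-≤
        ; *-monoˡ-≤-nonNeg; *-monoʳ-≤-nonNeg; *-cancelˡ-≤-pos; nonNegative⁻¹
        ; nonNeg*nonNeg⇒nonNeg; nonPos*nonPos⇒nonPos
        ; +-identityʳ; +-inverseʳ; +-assoc; *-identityʳ; *-identityˡ; *-zeroˡ; *-zeroʳ
        ; +-comm; *-assoc; *-comm; *-distribˡ-+; *-distribʳ-+; +-*-ring; module ≤-Reasoning)
open import Data.Rational.Solver using (module +-*-Solver)
open import Data.Vec using ([]; _∷_; insertAt)
open import Data.Vec.Properties using (insertAt-lookup; insertAt-punchIn; []=⇒lookup; lookup⇒[]=)
open import Function using (_∘_)
open import Relation.Binary.PropositionalEquality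
  using (_≡_; _≢_; refl; sym; trans; cong; cong₂; subst₂)
open import Relation.Nullary using (yes; no)

open import Algebra.Properties.Semiring.Sum (Ring.semiring +-*-ring)
  using (sum; sum-syntax; sum-cong-≗; sum-replicate-zero; sum-remove; ∑-distrib-+; *-distribˡ-sum)
open +-*-Solver
open ≤-Reasoning

*-monoˡ-≤′ : ∀ {r p q} → 0ℚ ≤ r → p ≤ q → r * p ≤ r * q
*-monoˡ-≤′ {r} 0≤r = *-monoˡ-≤-nonNeg r {{nonNegative 0≤r}}

*-monoʳ-≤′ : ∀ {r p q} → 0ℚ ≤ r → p ≤ q → p * r ≤ q * r
*-monoʳ-≤′ {r} 0≤r = *-monoʳ-≤-nonNeg r {{nonNegative 0≤r}}

0≤p*q : ∀ {p q} → 0ℚ ≤ p → 0ℚ ≤ q → 0ℚ ≤ p * q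
0≤p*q {p} {q} 0≤p 0≤q =
  nonNegative⁻¹ (p * q) {{nonNeg*nonNeg⇒nonNeg p {{nonNegative 0≤p}} q {{nonNegative 0≤q}}}}

0≤p*p : ∀ p → 0ℚ ≤ p * p
0≤p*p p with ≤-total 0ℚ p
... | inj₁ 0≤p = 0≤p*q 0≤p 0≤p
... | inj₂ p≤0 =
  nonNegative⁻¹ (p * p) {{nonPos*nonPos⇒nonPos p {{nonPositive p≤0}} p {{nonPositive p≤0}}}}

p≤p+q : ∀ p {q} → 0ℚ ≤ q → p ≤ p + q
p≤p+q p 0≤q = ≤-trans (≤-reflexive (sym (+-identityʳ p))) (+-monoʳ-≤ p 0≤q)

0≤1-p : ∀ {p} → p ≤ 1ℚ → 0ℚ ≤ 1ℚ - p
0≤1-p {p} p≤1 = ≤-trans (≤-reflexive (sym (+-inverseʳ p))) (+-monoˡ-≤ (- p) p≤1)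

2xy≤x²+y² : ∀ x y → (1ℚ + 1ℚ) * (x * y) ≤ x * x + y * y
2xy≤x²+y² x y = ≤-trans (p≤p+q _ (0≤p*p (x - y))) (≤-reflexive
  (solve 2 (λ x y → (con 1ℚ :+ con 1ℚ) :* (x :* y) :+ (x :- y) :* (x :- y) := x :* x :+ y :* y)
         refl x y))

x+y≤M⇒[x+y]²≤2Mx+y² : ∀ {x y M} → 0ℚ ≤ x → x + y ≤ M →
                       (x + y) * (x + y) ≤ (1ℚ + 1ℚ) * M * x + y * y
x+y≤M⇒[x+y]²≤2Mx+y² {x} {y} {M} 0≤x x+y≤M = begin
    (x + y) * (x + y)
  ≡⟨ solve 2 (λ x y → (x :+ y) :* (x :+ y) := (x :+ y) :* x :+ (x :* y :+ y :* y)) refl x y ⟩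
    (x + y) * x + (x * y + y * y)
  ≤⟨ +-mono-≤ (*-monoʳ-≤′ 0≤x x+y≤M) (+-monoˡ-≤ (y * y) (*-monoˡ-≤′ 0≤x y≤M)) ⟩
    M * x + (x * M + y * y)
  ≡⟨ solve 3 (λ x y M → M :* x :+ (x :* M :+ y :* y) := (con 1ℚ :+ con 1ℚ) :* M :* x :+ y :* y)
             refl x y M ⟩
    (1ℚ + 1ℚ) * M * x + y * y ∎
  where
  y≤M : y ≤ M
  y≤M = ≤-trans (≤-trans (p≤p+q y 0≤x) (≤-reflexive (+-comm y x))) x+y≤M

listSum : ∀ {A : Set} → (A → ℚ) → List A → ℚ
listSum h L = foldr _+_ 0ℚ (map h L)

listSum-cong : ∀ {A : Set} {h k : A → ℚ} (L : List A) → (∀ a → h a ≡ k a) →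
               listSum h L ≡ listSum k L
listSum-cong []      h≗k = refl
listSum-cong (a ∷ L) h≗k = cong₂ _+_ (h≗k a) (listSum-cong L h≗k)

*-distribˡ-listSum : ∀ {A : Set} c (h : A → ℚ) (L : List A) →
                     c * listSum h L ≡ listSum (λ a → c * h a) L
*-distribˡ-listSum c h []      = *-zeroʳ c
*-distribˡ-listSum c h (a ∷ L) =
  trans (*-distribˡ-+ c (h a) _) (cong (c * h a +_) (*-distribˡ-listSum c h L))

listSum-linear : ∀ {A : Set} c d (h k : A → ℚ) (L : List A) →
                 listSum (λ a → c * h a + d * k a) L ≡ c * listSum h L + d * listSum k L
listSum-linear c d h k []      = solve 2 (λ c d → con 0ℚ := c :* con 0ℚ :+ d :* con 0ℚ) refl c d
listSum-linear c d h k (a ∷ L) = trans (cong (c * h a + d * k a +_) (listSum-linear c d h k L))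
  (solve 6 (λ c d x y s t → c :* x :+ d :* y :+ (c :* s :+ d :* t) := c :* (x :+ s) :+ d :* (y :+ t))
         refl c d (h a) (k a) (listSum h L) (listSum k L))

sumSubsets-suc : ∀ n (h : Subset (suc n) → ℚ) →
                 sumSubsets (suc n) h ≡ sumSubsets n (λ A → h (true ∷ A) + h (false ∷ A))
sumSubsets-suc n h = go (allSubsets n)
  where
  go : (L : List (Subset n)) →
       listSum h (concatMap (λ A → (true ∷ A) ∷ (false ∷ A) ∷ []) L)
         ≡ listSum (λ A → h (true ∷ A) + h (false ∷ A)) L
  go []      = refl
  go (A ∷ L) = trans (cong (λ s → h (true ∷ A) + (h (false ∷ A) + s)) (go L))
    (sym (+-assoc (h (true ∷ A)) (h (false ∷ A)) _))

sum-zeros : ∀ {n} {t : Fin n → ℚ} → (∀ i → t i ≡ 0ℚ) → sum t ≡ 0ℚ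
sum-zeros {n} t≗0 = trans (sum-cong-≗ t≗0) (sum-replicate-zero n)

sum-mono-≤ : ∀ {n} {s t : Fin n → ℚ} → (∀ i → s i ≤ t i) → sum s ≤ sum t
sum-mono-≤ {zero}  s≤t = ≤-refl
sum-mono-≤ {suc n} s≤t = +-mono-≤ (s≤t zero) (sum-mono-≤ (s≤t ∘ suc))

2∑xy≤∑x²+∑y² : ∀ {n} (x y : Fin n → ℚ) →
               (1ℚ + 1ℚ) * ∑[ i < n ] (x i * y i)
                 ≤ ∑[ i < n ] (x i * x i) + ∑[ i < n ] (y i * y i)
2∑xy≤∑x²+∑y² {n} x y = begin
    (1ℚ + 1ℚ) * ∑[ i < n ] (x i * y i)   ≡⟨ *-distribˡ-sum (1ℚ + 1ℚ) (λ i → x i * y i) ⟩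
    ∑[ i < n ] ((1ℚ + 1ℚ) * (x i * y i)) ≤⟨ sum-mono-≤ (λ i → 2xy≤x²+y² (x i) (y i)) ⟩
    ∑[ i < n ] (x i * x i + y i * y i)   ≡⟨ ∑-distrib-+ (λ i → x i * x i) (λ i → y i * y i) ⟩
    ∑[ i < n ] (x i * x i) + ∑[ i < n ] (y i * y i) ∎

argmax : ∀ {m} (v : Fin (suc m) → ℚ) → ∃ λ j → ∀ i → v i ≤ v j
argmax {zero}  v = zero , λ { zero → ≤-refl }
argmax {suc m} v with argmax (v ∘ suc)
... | j , v≤vj with ≤-total (v zero) (v (suc j))
...   | inj₁ v₀≤vj = suc j , λ { zero → v₀≤vj ; (suc i) → v≤vj i }
...   | inj₂ vj≤v₀ = zero  , λ { zero → ≤-refl ; (suc i) → ≤-trans (v≤vj i) vj≤v₀ }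

indicator : ∀ {k} → Maybe (Fin k) → Fin k → ℚ
indicator nothing  i = 0ℚ
indicator (just x) i with x ≟ i
... | yes _ = 1ℚ
... | no  _ = 0ℚ

indicator-self : ∀ {k} (x : Fin k) → indicator (just x) x ≡ 1ℚ
indicator-self x with x ≟ x
... | yes _   = refl
... | no  x≢x = ⊥-elim (x≢x refl)

indicator-≢ : ∀ {k} {y : Maybe (Fin k)} {i} → y ≢ just i → indicator y i ≡ 0ℚ
indicator-≢ {y = nothing} y≢i = refl
indicator-≢ {y = just x} {i} y≢i with x ≟ i
... | yes refl = ⊥-elim (y≢i refl)
... | no  _    = refl

indicator-punchIn : ∀ {m} (x : Fin (suc m)) i → indicator (just x) (punchIn x i) ≡ 0ℚ
indicator-punchIn x i = indicator-≢ (λ e → punchInᵢ≢i x i (sym (just-injective e)))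

indicator-nonNeg : ∀ {k} (y : Maybe (Fin k)) i → 0ℚ ≤ indicator y i
indicator-nonNeg nothing  i = ≤-refl
indicator-nonNeg (just x) i with x ≟ i
... | yes _ = nonNegative⁻¹ 1ℚ
... | no  _ = ≤-refl

∑-sift : ∀ {k} (h : Fin k → ℚ) x → ∑[ i < k ] (h i * indicator (just x) i) ≡ h x
∑-sift {suc m} h x = begin-equality
    ∑[ i < suc m ] (h i * indicator (just x) i)
  ≡⟨ sum-remove {i = x} (λ i → h i * indicator (just x) i) ⟩
    h x * indicator (just x) x + ∑[ i < m ] (h (punchIn x i) * indicator (just x) (punchIn x i))
  ≡⟨ cong₂ _+_ (cong (h x *_) (indicator-self x))
               (sum-zeros (λ i → trans (cong (h (punchIn x i) *_) (indicator-punchIn x i))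
                                       (*-zeroʳ (h (punchIn x i))))) ⟩
    h x * 1ℚ + 0ℚ
  ≡⟨ trans (+-identityʳ _) (*-identityʳ (h x)) ⟩
    h x ∎

∑-indicator≤1 : ∀ {k} (y : Maybe (Fin k)) → ∑[ i < k ] indicator y i ≤ 1ℚ
∑-indicator≤1 {k} nothing  = ≤-trans (≤-reflexive (sum-replicate-zero k)) (nonNegative⁻¹ 1ℚ)
∑-indicator≤1 {k} (just x) = ≤-reflexive
  (trans (sum-cong-≗ {k} (λ i → sym (*-identityˡ (indicator (just x) i)))) (∑-sift (λ _ → 1ℚ) x))

punchOutMaybe : ∀ {m} → Fin (suc m) → Maybe (Fin (suc m)) → Maybe (Fin m)
punchOutMaybe j nothing  = nothing
punchOutMaybe j (just x) with j ≟ x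
... | yes _   = nothing
... | no  j≢x = just (punchOut j≢x)

indicator-punchOutMaybe : ∀ {m} (j : Fin (suc m)) y i →
                          indicator (punchOutMaybe j y) i ≡ indicator y (punchIn j i)
indicator-punchOutMaybe j nothing  i = refl
indicator-punchOutMaybe j (just x) i with j ≟ x
... | yes refl = sym (indicator-punchIn j i)
... | no  j≢x with punchOut j≢x ≟ i
...   | yes refl = sym (trans (cong (indicator (just x)) (punchIn-punchOut j≢x)) (indicator-self x))
...   | no  ≢i   = sym (indicator-≢ λ e →
                     ≢i (punchIn-injective j _ _ (trans (punchIn-punchOut j≢x) (just-injective e))))

punchOutMaybe≡just : ∀ {m} (j : Fin (suc m)) y {i} →
                     punchOutMaybe j y ≡ just i → y ≡ just (punchIn j i)
punchOutMaybe≡just j (just x) e with j ≟ x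
punchOutMaybe≡just j (just x) refl | no j≢x = cong just (sym (punchIn-punchOut j≢x))

PartialChoice : ∀ {n} → (Subset n → Maybe (Fin n)) → Set
PartialChoice f = ∀ A {x} → f A ≡ just x → x ∈ A

onNonempty : ∀ {n} → (Subset n → Fin n) → Subset n → Maybe (Fin n)
onNonempty f A with nonempty? A
... | yes _ = just (f A)
... | no  _ = nothing

onNonempty-partialChoice : ∀ {n} (f : Subset n → Fin n) → (∀ A → Nonempty A → f A ∈ A) →
                           PartialChoice (onNonempty f)
onNonempty-partialChoice f f∈ A e with nonempty? A
onNonempty-partialChoice f f∈ A refl | yes A≢∅ = f∈ A A≢∅

agree≡∑indicator*indicator : ∀ {n} (f g : Subset n → Fin n) A B →
                    agree f g A B
                      ≡ ∑[ i < n ] (indicator (onNonempty f A) i * indicator (onNonempty g B) i)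
agree≡∑indicator*indicator {n} f g A B with nonempty? A | nonempty? B
... | yes _ | yes _ rewrite ∑-sift (indicator (just (f A))) (g B) with f A ≟ g B
...   | yes _ = refl
...   | no  _ = refl
agree≡∑indicator*indicator f g A B | yes _ | no  _ =
  sym (sum-zeros (λ i → *-zeroʳ (indicator (just (f A)) i)))
agree≡∑indicator*indicator f g A B | no  _ | yes _ =
  sym (sum-zeros (λ i → *-zeroˡ (indicator (just (g B)) i)))
agree≡∑indicator*indicator {n} f g A B | no  _ | no  _ = sym (sum-zeros {n} (λ i → *-zeroˡ 0ℚ))

restrict : ∀ {m} → Fin (suc m) → (Subset (suc m) → Maybe (Fin (suc m))) → Subset m → Maybe (Fin m)
restrict j f A = punchOutMaybe j (f (insertAt A j false))

restrict-partialChoice : ∀ {m} (j : Fin (suc m)) {f} → PartialChoice f → PartialChoice (restrict j f)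
restrict-partialChoice j {f} choice A {i} e = lookup⇒[]= i A (trans (sym (insertAt-punchIn A j false i))
  ([]=⇒lookup (choice (insertAt A j false) (punchOutMaybe≡just j (f (insertAt A j false)) e))))

partialChoice-avoids : ∀ {m} (j : Fin (suc m)) {f} → PartialChoice f →
                       ∀ A → f (insertAt A j false) ≢ just j
partialChoice-avoids j choice A e
  with trans (sym ([]=⇒lookup (choice (insertAt A j false) e))) (insertAt-lookup A j false)
... | ()

-- Expectation over a p-biased random subset

module Expectation (p : ℚ) where

  q : ℚ
  q = 1ℚ - p

  expect : (n : ℕ) → (Subset n → ℚ) → ℚ
  expect zero    h = h []
  expect (suc n) h = p * expect n (λ A → h (true ∷ A)) + q * expect n (λ A → h (false ∷ A))

  sumSubsets-weight≡expect : ∀ n (h : Subset n → ℚ) →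
                             sumSubsets n (λ A → weight p A * h A) ≡ expect n h
  sumSubsets-weight≡expect zero    h = trans (+-identityʳ _) (*-identityˡ (h []))
  sumSubsets-weight≡expect (suc n) h = begin-equality
      sumSubsets (suc n) (λ A → weight p A * h A)
    ≡⟨ sumSubsets-suc n _ ⟩
      sumSubsets n (λ A → p * weight p A * h (true ∷ A) + q * weight p A * h (false ∷ A))
    ≡⟨ listSum-cong (allSubsets n) (λ A → cong₂ _+_ (*-assoc p _ _) (*-assoc q _ _)) ⟩
      sumSubsets n (λ A → p * (weight p A * h (true ∷ A)) + q * (weight p A * h (false ∷ A)))
    ≡⟨ listSum-linear p q _ _ (allSubsets n) ⟩
      p * sumSubsets n (λ A → weight p A * h (true ∷ A))
        + q * sumSubsets n (λ A → weight p A * h (false ∷ A))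
    ≡⟨ cong₂ (λ s t → p * s + q * t) (sumSubsets-weight≡expect n _)
                                     (sumSubsets-weight≡expect n _) ⟩
      expect (suc n) h ∎

  expect-cong : ∀ {n} {h k : Subset n → ℚ} → (∀ A → h A ≡ k A) → expect n h ≡ expect n k
  expect-cong {zero}  h≗k = h≗k []
  expect-cong {suc n} h≗k =
    cong₂ (λ s t → p * s + q * t) (expect-cong (h≗k ∘ (true ∷_)))
                                  (expect-cong (h≗k ∘ (false ∷_)))

  expect-const : ∀ n c → expect n (λ _ → c) ≡ c
  expect-const zero    c = refl
  expect-const (suc n) c = trans (cong₂ (λ s t → p * s + q * t) (expect-const n c) (expect-const n c))
    (solve 2 (λ p c → p :* c :+ (con 1ℚ :- p) :* c := c) refl p c)

  expect-+ : ∀ n (h k : Subset n → ℚ) → expect n (λ A → h A + k A) ≡ expect n h + expect n k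
  expect-+ zero    h k = refl
  expect-+ (suc n) h k = trans (cong₂ (λ s t → p * s + q * t) (expect-+ n _ _) (expect-+ n _ _))
    (solve 6 (λ p q a b c d → p :* (a :+ b) :+ q :* (c :+ d) := (p :* a :+ q :* c) :+ (p :* b :+ q :* d))
           refl p q _ _ _ _)

  expect-*ˡ : ∀ n c (h : Subset n → ℚ) → expect n (λ A → c * h A) ≡ c * expect n h
  expect-*ˡ zero    c h = refl
  expect-*ˡ (suc n) c h = trans (cong₂ (λ s t → p * s + q * t) (expect-*ˡ n c _) (expect-*ˡ n c _))
    (solve 5 (λ p q c a b → p :* (c :* a) :+ q :* (c :* b) := c :* (p :* a :+ q :* b)) refl p q c _ _)

  expect-∑ : ∀ n {k} (H : Fin k → Subset n → ℚ) →
             expect n (λ A → ∑[ i < k ] H i A) ≡ ∑[ i < k ] expect n (H i)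
  expect-∑ n {zero}  H = expect-const n 0ℚ
  expect-∑ n {suc k} H =
    trans (expect-+ n (H zero) _) (cong (expect n (H zero) +_) (expect-∑ n (H ∘ suc)))

  expect-independent : ∀ n m (h : Subset n → ℚ) (k : Subset m → ℚ) →
                       expect n (λ A → expect m (λ B → h A * k B)) ≡ expect n h * expect m k
  expect-independent n m h k = begin-equality
      expect n (λ A → expect m (λ B → h A * k B)) ≡⟨ expect-cong (λ A → expect-*ˡ m (h A) k) ⟩
      expect n (λ A → h A * expect m k)          ≡⟨ expect-cong (λ A → *-comm (h A) _) ⟩
      expect n (λ A → expect m k * h A)          ≡⟨ expect-*ˡ n (expect m k) h ⟩
      expect m k * expect n h                    ≡⟨ *-comm (expect m k) _ ⟩
      expect n h * expect m k ∎

  expect-insertAt : ∀ m (j : Fin (suc m)) (h : Subset (suc m) → ℚ) →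
    expect (suc m) h
      ≡ p * expect m (λ A → h (insertAt A j true)) + q * expect m (λ A → h (insertAt A j false))
  expect-insertAt m       zero    h = refl
  expect-insertAt (suc m) (suc j) h =
    trans (cong₂ (λ s t → p * s + q * t) (expect-insertAt m j (h ∘ (true ∷_)))
                                         (expect-insertAt m j (h ∘ (false ∷_))))
    (solve 6 (λ p q a b c d → p :* (p :* a :+ q :* b) :+ q :* (p :* c :+ q :* d)
                            := p :* (p :* a :+ q :* c) :+ q :* (p :* b :+ q :* d))
           refl p q _ _ _ _)

  expect-mono : 0ℚ ≤ p → p ≤ 1ℚ → ∀ n {h k : Subset n → ℚ} →
                (∀ A → h A ≤ k A) → expect n h ≤ expect n k
  expect-mono 0≤p p≤1 zero    h≤k = h≤k []
  expect-mono 0≤p p≤1 (suc n) h≤k = +-mono-≤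
    (*-monoˡ-≤′ 0≤p (expect-mono 0≤p p≤1 n (h≤k ∘ (true ∷_))))
    (*-monoˡ-≤′ (0≤1-p p≤1) (expect-mono 0≤p p≤1 n (h≤k ∘ (false ∷_))))

  selectProb : ∀ {n k} → (Subset n → Maybe (Fin k)) → Fin k → ℚ
  selectProb {n} f i = expect n (λ A → indicator (f A) i)

  collisionProb : ∀ {n k} → (Subset n → Maybe (Fin k)) → ℚ
  collisionProb {k = k} f = ∑[ i < k ] (selectProb f i * selectProb f i)

  successProb≡∑selectProb*selectProb : ∀ n (f g : Subset n → Fin n) →
    successProb n p f g ≡ ∑[ i < n ] (selectProb (onNonempty f) i * selectProb (onNonempty g) i)
  successProb≡∑selectProb*selectProb n f g = begin-equality
      successProb n p f g
    ≡⟨ listSum-cong (allSubsets n) inner ⟩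
      sumSubsets n (λ A → weight p A * expect n (agree f g A))
    ≡⟨ sumSubsets-weight≡expect n _ ⟩
      expect n (λ A → expect n (agree f g A))
    ≡⟨ expect-cong (λ A → expect-cong (agree≡∑indicator*indicator f g A)) ⟩
      expect n (λ A → expect n (λ B → ∑[ i < n ] (F A i * G B i)))
    ≡⟨ expect-cong (λ A → expect-∑ n (λ i B → F A i * G B i)) ⟩
      expect n (λ A → ∑[ i < n ] expect n (λ B → F A i * G B i))
    ≡⟨ expect-∑ n (λ i A → expect n (λ B → F A i * G B i)) ⟩
      ∑[ i < n ] expect n (λ A → expect n (λ B → F A i * G B i))
    ≡⟨ sum-cong-≗ (λ i → expect-independent n n (λ A → F A i) (λ B → G B i)) ⟩
      ∑[ i < n ] (selectProb (onNonempty f) i * selectProb (onNonempty g) i) ∎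
    where
    F G : Subset n → Fin n → ℚ
    F A = indicator (onNonempty f A)
    G B = indicator (onNonempty g B)
    inner : ∀ A → sumSubsets n (λ B → weight p A * weight p B * agree f g A B)
                ≡ weight p A * expect n (agree f g A)
    inner A = trans (listSum-cong (allSubsets n) (λ B → *-assoc (weight p A) (weight p B) _))
              (trans (sym (*-distribˡ-listSum (weight p A) _ (allSubsets n)))
                     (cong (weight p A *_) (sumSubsets-weight≡expect n (agree f g A))))

-- The collision bound

module CollisionBound (p : ℚ) (0≤p : 0ℚ ≤ p) (p≤1 : p ≤ 1ℚ) where

  open Expectation p

  D : ℚ
  D = (1ℚ + 1ℚ) - p

  0≤D : 0ℚ ≤ D
  0≤D = ≤-trans (+-mono-≤ (nonNegative⁻¹ 1ℚ) (0≤1-p p≤1))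
                (≤-reflexive (solve 1 (λ p → con 1ℚ :+ (con 1ℚ :- p) := (con 1ℚ :+ con 1ℚ) :- p)
                                      refl p))

  selectProb-nonNeg : ∀ {n k} (f : Subset n → Maybe (Fin k)) i → 0ℚ ≤ selectProb f i
  selectProb-nonNeg {n} f i = ≤-trans (≤-reflexive (sym (expect-const n 0ℚ)))
                                      (expect-mono 0≤p p≤1 n (λ A → indicator-nonNeg (f A) i))

  ∑selectProb≤1 : ∀ {n k} (f : Subset n → Maybe (Fin k)) → ∑[ i < k ] selectProb f i ≤ 1ℚ
  ∑selectProb≤1 {n} {k} f = begin
    ∑[ i < k ] selectProb f i
      ≡⟨ expect-∑ n (λ i A → indicator (f A) i) ⟨
    expect n (λ A → ∑[ i < k ] indicator (f A) i)
      ≤⟨ expect-mono 0≤p p≤1 n (λ A → ∑-indicator≤1 (f A)) ⟩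
    expect n (λ _ → 1ℚ)
      ≡⟨ expect-const n 1ℚ ⟩
    1ℚ ∎

  collisionProb-step : ∀ {m} (u : ℚ) (α β : Fin m → ℚ) →
    0ℚ ≤ u → (∀ i → 0ℚ ≤ α i) → u + ∑[ i < m ] α i ≤ 1ℚ →
    (∀ i → p * α i + q * β i ≤ p * u) →
    ∑[ i < m ] (β i * β i) * D ≤ p →
    ((p * u) * (p * u) + ∑[ i < m ] ((p * α i + q * β i) * (p * α i + q * β i))) * D ≤ p
  collisionProb-step {m} u α β 0≤u 0≤α mass below-max ih = begin
      ((p * u) * (p * u) + ∑[ i < m ] (γ i * γ i)) * D
    ≤⟨ *-monoʳ-≤′ 0≤D (+-monoʳ-≤ ((p * u) * (p * u)) ∑γ²≤) ⟩
      ((p * u) * (p * u) + (c * (1ℚ - u) + q * q * T)) * D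
    ≡⟨ solve 6 (λ x c u q t d → (x :+ (c :* (con 1ℚ :- u) :+ q :* q :* t)) :* d
                              := (x :+ c :* (con 1ℚ :- u)) :* d :+ q :* q :* (t :* d))
               refl ((p * u) * (p * u)) c u q T D ⟩
      ((p * u) * (p * u) + c * (1ℚ - u)) * D + q * q * (T * D)
    ≤⟨ +-monoʳ-≤ (((p * u) * (p * u) + c * (1ℚ - u)) * D) (*-monoˡ-≤′ (0≤p*p q) ih) ⟩
      ((p * u) * (p * u) + c * (1ℚ - u)) * D + q * q * p
    ≤⟨ p≤p+q _ (0≤p*q (0≤p*q (0≤p*p p) 0≤D) (0≤p*p (1ℚ - u))) ⟩
      ((p * u) * (p * u) + c * (1ℚ - u)) * D + q * q * p + p * p * D * ((1ℚ - u) * (1ℚ - u))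
    -- the left side is p²(2 - p)(u² + 2u(1 - u) + (1 - u)²) + (1 - p)² p = p²(2 - p) + (1 - p)² p
    ≡⟨ solve 2 (λ p u → ((p :* u) :* (p :* u) :+ (con 1ℚ :+ con 1ℚ) :* (p :* p) :* u :* (con 1ℚ :- u))
                          :* ((con 1ℚ :+ con 1ℚ) :- p)
                        :+ (con 1ℚ :- p) :* (con 1ℚ :- p) :* p
                        :+ p :* p :* ((con 1ℚ :+ con 1ℚ) :- p) :* ((con 1ℚ :- u) :* (con 1ℚ :- u)) := p)
               refl p u ⟩
      p ∎
    where
    γ : Fin m → ℚ
    γ i = p * α i + q * β i
    c T : ℚ
    c = (1ℚ + 1ℚ) * (p * p) * u
    T = ∑[ i < m ] (β i * β i)
    0≤c : 0ℚ ≤ c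
    0≤c = 0≤p*q (0≤p*q (+-mono-≤ (nonNegative⁻¹ 1ℚ) (nonNegative⁻¹ 1ℚ)) (0≤p*p p)) 0≤u
    γ²≤ : ∀ i → γ i * γ i ≤ c * α i + q * q * (β i * β i)
    γ²≤ i = ≤-trans
      (x+y≤M⇒[x+y]²≤2Mx+y² (0≤p*q 0≤p (0≤α i)) (below-max i))
      (≤-reflexive (solve 5 (λ p u a q b → (con 1ℚ :+ con 1ℚ) :* (p :* u) :* (p :* a) :+ (q :* b) :* (q :* b)
                                       := (con 1ℚ :+ con 1ℚ) :* (p :* p) :* u :* a :+ q :* q :* (b :* b))
                            refl p u (α i) q (β i)))
    ∑α≤1-u : ∑[ i < m ] α i ≤ 1ℚ - u
    ∑α≤1-u = ≤-trans (≤-reflexive (solve 2 (λ u s → s := u :+ s :+ (:- u)) refl u (∑[ i < m ] α i)))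
                     (+-monoˡ-≤ (- u) mass)
    ∑γ²≤ : ∑[ i < m ] (γ i * γ i) ≤ c * (1ℚ - u) + q * q * T
    ∑γ²≤ = begin
      ∑[ i < m ] (γ i * γ i)
        ≤⟨ sum-mono-≤ γ²≤ ⟩
      ∑[ i < m ] (c * α i + q * q * (β i * β i))
        ≡⟨ ∑-distrib-+ (λ i → c * α i) (λ i → q * q * (β i * β i)) ⟩
      ∑[ i < m ] (c * α i) + ∑[ i < m ] (q * q * (β i * β i))
        ≡⟨ cong₂ _+_ (*-distribˡ-sum c α) (*-distribˡ-sum (q * q) (λ i → β i * β i)) ⟨
      c * ∑[ i < m ] α i + q * q * T
        ≤⟨ +-monoˡ-≤ (q * q * T) (*-monoˡ-≤′ 0≤c ∑α≤1-u) ⟩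
      c * (1ℚ - u) + q * q * T ∎

  collisionProb-bound : ∀ n (f : Subset n → Maybe (Fin n)) → PartialChoice f →
                        collisionProb f * D ≤ p
  collisionProb-bound zero    f _      = ≤-trans (≤-reflexive (*-zeroˡ D)) 0≤p
  collisionProb-bound (suc m) f choice with argmax (selectProb f)
  ... | j , a≤aj = begin
      collisionProb f * D
    ≡⟨ cong (_* D) (trans (sum-remove {i = j} (λ i → a i * a i))
                          (cong₂ _+_ (cong₂ _*_ aj≡pu aj≡pu)
                                     (sum-cong-≗ (λ i → cong₂ _*_ (a-punchIn i) (a-punchIn i))))) ⟩
      ((p * u) * (p * u) + ∑[ i < m ] ((p * α i + q * β i) * (p * α i + q * β i))) * D
    ≤⟨ collisionProb-step u α β (selectProb-nonNeg f₁ j) (selectProb-nonNeg f₁ ∘ punchIn j)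
         mass below-max
         (collisionProb-bound m (restrict j f) (restrict-partialChoice j choice)) ⟩
      p ∎
    where
    a : Fin (suc m) → ℚ
    a = selectProb f
    f₁ f₀ : Subset m → Maybe (Fin (suc m))
    f₁ A = f (insertAt A j true)
    f₀ A = f (insertAt A j false)
    u : ℚ
    u = selectProb f₁ j
    α β : Fin m → ℚ
    α = selectProb f₁ ∘ punchIn j
    β = selectProb (restrict j f)
    aj≡pu : a j ≡ p * u
    aj≡pu = begin-equality
      a j
        ≡⟨ expect-insertAt m j (λ A → indicator (f A) j) ⟩
      p * u + q * selectProb f₀ j
        ≡⟨ cong (λ t → p * u + q * t) (expect-cong (λ A → indicator-≢ (partialChoice-avoids j choice A))) ⟩
      p * u + q * expect m (λ _ → 0ℚ)
        ≡⟨ cong (λ t → p * u + q * t) (expect-const m 0ℚ) ⟩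
      p * u + q * 0ℚ
        ≡⟨ solve 2 (λ x q → x :+ q :* con 0ℚ := x) refl (p * u) q ⟩
      p * u ∎
    a-punchIn : ∀ i → a (punchIn j i) ≡ p * α i + q * β i
    a-punchIn i = trans (expect-insertAt m j (λ A → indicator (f A) (punchIn j i)))
      (cong (λ t → p * α i + q * t) (expect-cong (λ A → sym (indicator-punchOutMaybe j (f₀ A) i))))
    mass : u + ∑[ i < m ] α i ≤ 1ℚ
    mass = ≤-trans (≤-reflexive (sym (sum-remove {i = j} (selectProb f₁)))) (∑selectProb≤1 f₁)
    below-max : ∀ i → p * α i + q * β i ≤ p * u
    below-max i = subst₂ _≤_ (a-punchIn i) aj≡pu (a≤aj (punchIn j i))

lemma1p5 : (n : ℕ) → n ≥ 1 → (p : ℚ) → 0ℚ ≤ p → p ≤ 1ℚ →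
    (f g : Subset n → Fin n) →
    (∀ A → Nonempty A → f A ∈ A) →
    (∀ B → Nonempty B → g B ∈ B) →
    successProb n p f g * ((1ℚ + 1ℚ) - p) ≤ p
lemma1p5 n _ p 0≤p p≤1 f g f∈ g∈ = *-cancelˡ-≤-pos (1ℚ + 1ℚ) (begin
    (1ℚ + 1ℚ) * (successProb n p f g * D)
  ≡⟨ trans (cong (λ s → (1ℚ + 1ℚ) * (s * D)) (successProb≡∑selectProb*selectProb n f g))
           (sym (*-assoc (1ℚ + 1ℚ) (∑[ i < n ] (a i * b i)) D)) ⟩
    (1ℚ + 1ℚ) * ∑[ i < n ] (a i * b i) * D
  ≤⟨ *-monoʳ-≤′ 0≤D (2∑xy≤∑x²+∑y² a b) ⟩
    (collisionProb (onNonempty f) + collisionProb (onNonempty g)) * D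
  ≡⟨ *-distribʳ-+ D (collisionProb (onNonempty f)) _ ⟩
    collisionProb (onNonempty f) * D + collisionProb (onNonempty g) * D
  ≤⟨ +-mono-≤ (collisionProb-bound n _ (onNonempty-partialChoice f f∈))
              (collisionProb-bound n _ (onNonempty-partialChoice g g∈)) ⟩
    p + p
  ≡⟨ solve 1 (λ p → p :+ p := (con 1ℚ :+ con 1ℚ) :* p) refl p ⟩
    (1ℚ + 1ℚ) * p ∎)
  where
  open Expectation p
  open CollisionBound p 0≤p p≤1
  a b : Fin n → ℚ
  a = selectProb (onNonempty f)
  b = selectProb (onNonempty g)
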